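{- Let $g$ be an odd integer with $g\ge3$. Every nonzero integer $n$ has a unique representation in the form $n=\sum_{i=0}^{\infty}\varepsilon_i g^i$ where (i) $\varepsilon_i\in\{0,\pm1,\pm2,\ldots,\pm(g-1)/2\}$ for all nonnegative integers $i$; (ii) $\varepsilon_i\neq0$ for only finitely many $i$. Moreover, $\ell_g(n)=\sum_{i=0}^{\infty}|\varepsilon_i|$.
   Context: Consider the additive group $\mathbf{Z}$ with generating set $A_g=\{0\}\cup\{\pm g^i:i=0,1,2,\ldots\}$. The word length $\ell_g(n)$ is $0$ if $n=0$, and otherwise the least positive integer $r$ such that $n$ is a sum of $r$ elements of $A_g$. This defines the metric $d_g(m,n)=\ell_g(m-n)$ on $\mathbf{Z}$. -}

module Defs where

open import Data.Nat as ℕ using (ℕ; zero; suc)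
open import Data.Integer as ℤ using (ℤ; +_; -_; ∣_∣)
open import Data.List using (List; length)
open import Data.List.Relation.Unary.All using (All)
open import Data.Product using (Σ; ∃; _×_)
open import Data.Sum using (_⊎_)
open import Relation.Binary.PropositionalEquality using (_≡_; _≢_)

InA : ℕ → ℤ → Set
InA g a = (a ≡ + 0) ⊎ (∃ λ i → a ≡ + (g ℕ.^ i)) ⊎ (∃ λ i → a ≡ - (+ (g ℕ.^ i)))

sumℤ : List ℤ → ℤ
sumℤ List.[] = + 0
sumℤ (x List.∷ xs) = x ℤ.+ sumℤ xs

SumOf : ℕ → ℕ → ℤ → Set
SumOf g r n = Σ (List ℤ) λ xs → (length xs ≡ r) × All (InA g) xs × (sumℤ xs ≡ n)

IsWordLength : ℕ → ℤ → ℕ → Set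
IsWordLength g n r =
  (n ≡ + 0 → r ≡ 0) ×
  (n ≢ + 0 → (1 ℕ.≤ r) × SumOf g r n × (∀ s → 1 ℕ.≤ s → SumOf g s n → r ℕ.≤ s))

Σ< : ℕ → (ℕ → ℤ) → ℤ
Σ< zero f = + 0
Σ< (suc N) f = Σ< N f ℤ.+ f N

Σℕ< : ℕ → (ℕ → ℕ) → ℕ
Σℕ< zero f = 0
Σℕ< (suc N) f = Σℕ< N f ℕ.+ f N

digitValue : ℕ → (ℕ → ℤ) → ℕ → ℤ
digitValue g ε N = Σ< N (λ i → ε i ℤ.* + (g ℕ.^ i))

-- condition (i): ε_i ∈ {0, ±1, …, ±(g-1)/2}, i.e. 2|ε_i| ≤ g - 1
DigitsBounded : ℕ → (ℕ → ℤ) → Set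
DigitsBounded g ε = ∀ i → 2 ℕ.* ∣ ε i ∣ ℕ.≤ g ℕ.∸ 1

-- condition (ii), witnessed by a bound N: ε_i = 0 for all i ≥ N
SupportBelow : (ℕ → ℤ) → ℕ → Set
SupportBelow ε N = ∀ i → N ℕ.≤ i → ε i ≡ + 0

IsRep : ℕ → ℤ → (ℕ → ℤ) → ℕ → Set
IsRep g n ε N = DigitsBounded g ε × SupportBelow ε N × (n ≡ digitValue g ε N)

module Submission where

-- Every integer n has a unique balanced division n = d + q·g with |d| ≤ h:
-- Euclidean division followed, when the remainder exceeds h, by a shift of
-- the remainder into [-h, h].  Write D n for the digit d and Q n for the
-- quotient q.  For h ≥ 1 we have |Q n| ≤ |n| - 1, so iterating Q from n
-- reaches 0 after |n| steps, and ε_i = D (Qⁱ n) is a balanced expansion of n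
-- supported below |n|.  Uniqueness of the expansion follows digit by digit
-- from uniqueness of balanced division.
--
-- For the word length, the weight w n = Σ|ε_i| satisfies w n = |D n| + w (Q n).
-- The expansion itself writes n as a sum of w n generators; conversely
-- w (a + m) ≤ 1 + w m for every generator a (for a = 1 by induction on |m|,
-- carrying when the last digit is h; for a = g^i by induction on i; for
-- a = -g^i by the symmetry w (-n) = w n), so no shorter sum exists.

open import Defs
open import Data.Nat as ℕ using (ℕ; zero; suc; _%_)
import Data.Nat.Properties as ℕP
import Data.Nat.DivMod as ℕD
open import Data.Integer as ℤ using (ℤ; +_; -_; ∣_∣; -[1+_])
import Data.Integer.Properties as ℤP
import Data.Integer.DivMod as ℤD
open import Data.Integer.Tactic.RingSolver using (solve-∀)
open import Data.List using (List; []; _∷_; _++_; replicate; length)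
import Data.List.Properties as ListP
open import Data.List.Relation.Unary.All using (All; []; _∷_)
import Data.List.Relation.Unary.All.Properties as AllP
open import Data.Product using (Σ; _×_; _,_; proj₁; proj₂)
open import Data.Sum using (inj₁; inj₂)
open import Data.Empty using (⊥-elim)
open import Relation.Nullary using (yes; no)
open import Relation.Binary.PropositionalEquality

Σ<-shift : ∀ K f → Σ< (suc K) f ≡ f 0 ℤ.+ Σ< K (λ i → f (suc i))
Σ<-shift zero f = ℤP.+-comm (+ 0) (f 0)
Σ<-shift (suc K) f =
  trans (cong (ℤ._+ f (suc K)) (Σ<-shift K f)) (ℤP.+-assoc (f 0) _ (f (suc K)))

Σ<-cong : ∀ K {f f′} → (∀ i → f i ≡ f′ i) → Σ< K f ≡ Σ< K f′
Σ<-cong zero f≗f′ = refl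
Σ<-cong (suc K) f≗f′ = cong₂ ℤ._+_ (Σ<-cong K f≗f′) (f≗f′ K)

Σ<-*ʳ : ∀ K f c → Σ< K (λ i → f i ℤ.* c) ≡ Σ< K f ℤ.* c
Σ<-*ʳ zero f c = sym (ℤP.*-zeroˡ c)
Σ<-*ʳ (suc K) f c =
  trans (cong (ℤ._+ f K ℤ.* c) (Σ<-*ʳ K f c)) (sym (ℤP.*-distribʳ-+ c (Σ< K f) (f K)))

Σℕ<-shift : ∀ K f → Σℕ< (suc K) f ≡ f 0 ℕ.+ Σℕ< K (λ i → f (suc i))
Σℕ<-shift zero f = ℕP.+-comm 0 (f 0)
Σℕ<-shift (suc K) f =
  trans (cong (ℕ._+ f (suc K)) (Σℕ<-shift K f)) (ℕP.+-assoc (f 0) _ (f (suc K)))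

Σℕ<-cong : ∀ K {f f′} → (∀ i → f i ≡ f′ i) → Σℕ< K f ≡ Σℕ< K f′
Σℕ<-cong zero f≗f′ = refl
Σℕ<-cong (suc K) f≗f′ = cong₂ ℕ._+_ (Σℕ<-cong K f≗f′) (f≗f′ K)

Σℕ<-extend : ∀ N K f → (∀ i → N ℕ.≤ i → f i ≡ 0) → N ℕ.≤ K → Σℕ< K f ≡ Σℕ< N f
Σℕ<-extend .0 zero f vanish ℕ.z≤n = refl
Σℕ<-extend N (suc K) f vanish N≤1+K with ℕP.m≤n⇒m<n∨m≡n N≤1+K
... | inj₂ refl = refl
... | inj₁ N<1+K = begin
  Σℕ< K f ℕ.+ f K ≡⟨ cong (Σℕ< K f ℕ.+_) (vanish K N≤K) ⟩
  Σℕ< K f ℕ.+ 0   ≡⟨ ℕP.+-identityʳ _ ⟩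
  Σℕ< K f         ≡⟨ Σℕ<-extend N K f vanish N≤K ⟩
  Σℕ< N f         ∎
  where
    open ≡-Reasoning
    N≤K : N ℕ.≤ K
    N≤K = ℕ.s≤s⁻¹ N<1+K

digitValue-shift : ∀ g δ K →
  digitValue g δ (suc K) ≡ δ 0 ℤ.+ digitValue g (λ i → δ (suc i)) K ℤ.* + g
digitValue-shift g δ K = begin
  digitValue g δ (suc K)
    ≡⟨ Σ<-shift K _ ⟩
  δ 0 ℤ.* + 1 ℤ.+ Σ< K (λ i → δ (suc i) ℤ.* + (g ℕ.^ suc i))
    ≡⟨ cong₂ ℤ._+_ (ℤP.*-identityʳ (δ 0)) (Σ<-cong K λ i → nextPlace (δ (suc i)) i) ⟩
  δ 0 ℤ.+ Σ< K (λ i → δ (suc i) ℤ.* + (g ℕ.^ i) ℤ.* + g)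
    ≡⟨ cong (λ y → δ 0 ℤ.+ y) (Σ<-*ʳ K (λ i → δ (suc i) ℤ.* + (g ℕ.^ i)) (+ g)) ⟩
  δ 0 ℤ.+ digitValue g (λ i → δ (suc i)) K ℤ.* + g ∎
  where
    open ≡-Reasoning
    reassociate : ∀ x a b → x ℤ.* (a ℤ.* b) ≡ x ℤ.* b ℤ.* a
    reassociate = solve-∀
    nextPlace : ∀ x i → x ℤ.* + (g ℕ.^ suc i) ≡ x ℤ.* + (g ℕ.^ i) ℤ.* + g
    nextPlace x i = trans (cong (x ℤ.*_) (ℤP.pos-* g (g ℕ.^ i))) (reassociate x (+ g) _)

sumℤ-++ : ∀ xs ys → sumℤ (xs ++ ys) ≡ sumℤ xs ℤ.+ sumℤ ys
sumℤ-++ [] ys = sym (ℤP.+-identityˡ (sumℤ ys))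
sumℤ-++ (x ∷ xs) ys =
  trans (cong (λ y → x ℤ.+ y) (sumℤ-++ xs ys)) (sym (ℤP.+-assoc x (sumℤ xs) (sumℤ ys)))

sumℤ-replicate : ∀ k x → sumℤ (replicate k x) ≡ + k ℤ.* x
sumℤ-replicate zero x = sym (ℤP.*-zeroˡ x)
sumℤ-replicate (suc k) x = begin
  x ℤ.+ sumℤ (replicate k x) ≡⟨ cong (λ y → x ℤ.+ y) (sumℤ-replicate k x) ⟩
  x ℤ.+ + k ℤ.* x            ≡⟨ cong (ℤ._+ + k ℤ.* x) (ℤP.*-identityˡ x) ⟨
  + 1 ℤ.* x ℤ.+ + k ℤ.* x    ≡⟨ ℤP.*-distribʳ-+ x (+ 1) (+ k) ⟨
  + suc k ℤ.* x              ∎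
  where open ≡-Reasoning

copies : ℤ → ℕ → List ℤ
copies (+ k) p = replicate k (+ p)
copies -[1+ k ] p = replicate (suc k) (- + p)

copies-length : ∀ c p → length (copies c p) ≡ ∣ c ∣
copies-length (+ k) p = ListP.length-replicate k
copies-length -[1+ k ] p = ListP.length-replicate (suc k)

copies-sum : ∀ c p → sumℤ (copies c p) ≡ c ℤ.* + p
copies-sum (+ k) p = sumℤ-replicate k (+ p)
copies-sum -[1+ k ] p = begin
  sumℤ (replicate (suc k) (- + p)) ≡⟨ sumℤ-replicate (suc k) (- + p) ⟩
  + suc k ℤ.* - + p                ≡⟨ ℤP.neg-distribʳ-* (+ suc k) (+ p) ⟨
  - (+ suc k ℤ.* + p)              ≡⟨ ℤP.neg-distribˡ-* (+ suc k) (+ p) ⟩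
  -[1+ k ] ℤ.* + p                 ∎
  where open ≡-Reasoning

copies-generators : ∀ g c i → All (InA g) (copies c (g ℕ.^ i))
copies-generators g (+ k) i = AllP.replicate⁺ k (inj₂ (inj₁ (i , refl)))
copies-generators g -[1+ k ] i = AllP.replicate⁺ (suc k) (inj₂ (inj₂ (i , refl)))

digitValue-asSum : ∀ g K ε → SumOf g (Σℕ< K (λ i → ∣ ε i ∣)) (digitValue g ε K)
digitValue-asSum g zero ε = [] , refl , [] , refl
digitValue-asSum g (suc K) ε with digitValue-asSum g K ε
... | xs , len , gens , sum = xs ++ copies (ε K) (g ℕ.^ K)
    , trans (ListP.length-++ xs) (cong₂ ℕ._+_ len (copies-length (ε K) _))
    , AllP.++⁺ gens (copies-generators g (ε K) K)
    , trans (sumℤ-++ xs _) (cong₂ ℤ._+_ sum (copies-sum (ε K) _))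

-- Balanced division by g = 2h+1

module BalancedDivision (h : ℕ) where

  g : ℕ
  g = suc (h ℕ.+ h)

  instance
    g-nonZero : ℕ.NonZero g
    g-nonZero = _

  Balanced : ℤ → Set
  Balanced d = ∣ d ∣ ℕ.≤ h

  balanced⇒bounded : ∀ d → Balanced d → 2 ℕ.* ∣ d ∣ ℕ.≤ g ℕ.∸ 1
  balanced⇒bounded d bal = ℕP.+-mono-≤ bal (ℕP.≤-trans (ℕP.≤-reflexive (ℕP.+-identityʳ ∣ d ∣)) bal)

  bounded⇒balanced : ∀ d → 2 ℕ.* ∣ d ∣ ℕ.≤ g ℕ.∸ 1 → Balanced d
  bounded⇒balanced d bnd =
    ℕP.*-cancelˡ-≤ 2 (ℕP.≤-trans bnd (ℕP.≤-reflexive (cong (h ℕ.+_) (sym (ℕP.+-identityʳ h)))))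

  -- Existence: Euclidean division, moving a remainder r > h down to r - g.
  balancedDivision : ∀ n → Σ ℤ λ d → Σ ℤ λ q → Balanced d × n ≡ d ℤ.+ q ℤ.* + g
  balancedDivision n with n ℤD.%ℕ g ℕ.≤? h
  ... | yes r≤h = + r , q , r≤h , ℤD.a≡a%ℕn+[a/ℕn]*n n g
    where
      r : ℕ
      r = n ℤD.%ℕ g
      q : ℤ
      q = n ℤD./ℕ g
  ... | no r≰h = + r ℤ.- + g , q ℤ.+ + 1 , shifted-balanced , shifted-division
    where
      r : ℕ
      r = n ℤD.%ℕ g
      q : ℤ
      q = n ℤD./ℕ g
      shifted-balanced : ∣ + r ℤ.- + g ∣ ℕ.≤ h
      shifted-balanced rewrite ℤP.[+m]-[+n]≡m⊖n r g | ℤP.∣⊖∣-< (ℤD.n%ℕd<d n g) =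
        ℕP.≤-trans (ℕP.∸-monoʳ-≤ g (ℕP.≰⇒> r≰h)) (ℕP.≤-reflexive (ℕP.m+n∸m≡n h h))
      carry : ∀ a b c → a ℤ.+ b ℤ.* c ≡ (a ℤ.- c) ℤ.+ (b ℤ.+ + 1) ℤ.* c
      carry = solve-∀
      shifted-division : n ≡ (+ r ℤ.- + g) ℤ.+ (q ℤ.+ + 1) ℤ.* + g
      shifted-division = trans (ℤD.a≡a%ℕn+[a/ℕn]*n n g) (carry (+ r) q (+ g))

  -- Uniqueness: two balanced digits differ by at most 2h < g, so the
  -- quotients, whose difference times g equals that of the digits, agree.
  balancedDivision-unique : ∀ {d q d′ q′} → Balanced d → Balanced d′ →
    d ℤ.+ q ℤ.* + g ≡ d′ ℤ.+ q′ ℤ.* + g → d ≡ d′ × q ≡ q′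
  balancedDivision-unique {d} {q} {d′} {q′} bal bal′ same = d≡d′ , q≡q′
    where
      difference : ∀ d q d′ q′ G →
        d′ ℤ.- d ≡ (q ℤ.- q′) ℤ.* G ℤ.+ ((d′ ℤ.+ q′ ℤ.* G) ℤ.- (d ℤ.+ q ℤ.* G))
      difference = solve-∀
      gap : d′ ℤ.- d ≡ (q ℤ.- q′) ℤ.* + g
      gap = begin
        d′ ℤ.- d
          ≡⟨ difference d q d′ q′ (+ g) ⟩
        (q ℤ.- q′) ℤ.* + g ℤ.+ ((d′ ℤ.+ q′ ℤ.* + g) ℤ.- (d ℤ.+ q ℤ.* + g))
          ≡⟨ cong (λ x → (q ℤ.- q′) ℤ.* + g ℤ.+ ((d′ ℤ.+ q′ ℤ.* + g) ℤ.- x)) same ⟩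
        (q ℤ.- q′) ℤ.* + g ℤ.+ ((d′ ℤ.+ q′ ℤ.* + g) ℤ.- (d′ ℤ.+ q′ ℤ.* + g))
          ≡⟨ cong (λ y → (q ℤ.- q′) ℤ.* + g ℤ.+ y) (ℤP.+-inverseʳ (d′ ℤ.+ q′ ℤ.* + g)) ⟩
        (q ℤ.- q′) ℤ.* + g ℤ.+ + 0
          ≡⟨ ℤP.+-identityʳ _ ⟩
        (q ℤ.- q′) ℤ.* + g ∎
        where open ≡-Reasoning
      scaled : ∣ q ℤ.- q′ ∣ ℕ.* g ℕ.≤ h ℕ.+ h
      scaled = begin
        ∣ q ℤ.- q′ ∣ ℕ.* g     ≡⟨ ℤP.abs-* (q ℤ.- q′) (+ g) ⟨
        ∣ (q ℤ.- q′) ℤ.* + g ∣ ≡⟨ cong ∣_∣ gap ⟨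
        ∣ d′ ℤ.- d ∣           ≤⟨ ℤP.∣i-j∣≤∣i∣+∣j∣ d′ d ⟩
        ∣ d′ ∣ ℕ.+ ∣ d ∣       ≤⟨ ℕP.+-mono-≤ bal′ bal ⟩
        h ℕ.+ h                ∎
        where open ℕP.≤-Reasoning
      below-g⇒zero : ∀ k → k ℕ.* g ℕ.≤ h ℕ.+ h → k ≡ 0
      below-g⇒zero zero _ = refl
      below-g⇒zero (suc k) kg≤2h =
        ⊥-elim (ℕP.<-irrefl refl (ℕP.≤-trans (ℕP.m≤m+n g (k ℕ.* g)) kg≤2h))
      q-q′≡0 : q ℤ.- q′ ≡ + 0
      q-q′≡0 = ℤP.∣i∣≡0⇒i≡0 (below-g⇒zero _ scaled)
      q≡q′ : q ≡ q′
      q≡q′ = ℤP.i-j≡0⇒i≡j q q′ q-q′≡0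
      d≡d′ : d ≡ d′
      d≡d′ = sym (ℤP.i-j≡0⇒i≡j d′ d
        (trans gap (trans (cong (ℤ._* + g) q-q′≡0) (ℤP.*-zeroˡ (+ g)))))

  D : ℤ → ℤ
  D n = proj₁ (balancedDivision n)

  Q : ℤ → ℤ
  Q n = proj₁ (proj₂ (balancedDivision n))

  D-balanced : ∀ n → Balanced (D n)
  D-balanced n = proj₁ (proj₂ (proj₂ (balancedDivision n)))

  D-Q-spec : ∀ n → n ≡ D n ℤ.+ Q n ℤ.* + g
  D-Q-spec n = proj₂ (proj₂ (proj₂ (balancedDivision n)))

  D-Q-unique : ∀ {n d q} → Balanced d → n ≡ d ℤ.+ q ℤ.* + g → D n ≡ d × Q n ≡ q
  D-Q-unique {n} bal spec =
    balancedDivision-unique (D-balanced n) bal (trans (sym (D-Q-spec n)) spec)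

  D-zero : D (+ 0) ≡ + 0
  D-zero = proj₁ (D-Q-unique {+ 0} {+ 0} {+ 0} ℕ.z≤n refl)

  D-Q-neg : ∀ n → D (- n) ≡ - D n × Q (- n) ≡ - Q n
  D-Q-neg n = D-Q-unique (subst (ℕ._≤ h) (sym (ℤP.∣-i∣≡∣i∣ (D n))) (D-balanced n)) (begin
    - n                          ≡⟨ cong -_ (D-Q-spec n) ⟩
    - (D n ℤ.+ Q n ℤ.* + g)      ≡⟨ ℤP.neg-distrib-+ (D n) (Q n ℤ.* + g) ⟩
    - D n ℤ.+ - (Q n ℤ.* + g)    ≡⟨ cong (λ y → - D n ℤ.+ y) (ℤP.neg-distribˡ-* (Q n) (+ g)) ⟩
    - D n ℤ.+ - Q n ℤ.* + g      ∎)
    where open ≡-Reasoning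

  -- The balanced expansion (needs h ≥ 1, i.e. g ≥ 3)

  module Expansion (h≥1 : 1 ℕ.≤ h) where

    quotient-shrinks : ∀ b a → b ℕ.* g ℕ.≤ a ℕ.+ h → b ℕ.≤ a ℕ.∸ 1
    quotient-shrinks zero a _ = ℕ.z≤n
    quotient-shrinks (suc b) a bg≤a+h =
      ℕP.∸-monoˡ-≤ 1 (ℕP.+-cancelˡ-≤ h (suc (suc b)) a (begin
        h ℕ.+ suc (suc b)       ≤⟨ ℕP.+-monoʳ-≤ h (ℕ.s≤s (ℕP.+-monoˡ-≤ b h≥1)) ⟩
        h ℕ.+ suc (h ℕ.+ b)     ≡⟨ trans (ℕP.+-suc h (h ℕ.+ b)) (cong suc (sym (ℕP.+-assoc h h b))) ⟩
        suc (h ℕ.+ h ℕ.+ b)     ≤⟨ ℕ.s≤s (ℕP.+-monoʳ-≤ (h ℕ.+ h) (ℕP.m≤m*n b g)) ⟩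
        suc b ℕ.* g             ≤⟨ bg≤a+h ⟩
        a ℕ.+ h                 ≡⟨ ℕP.+-comm a h ⟩
        h ℕ.+ a                 ∎))
      where open ℕP.≤-Reasoning

    -- Hence |Q n| < |n| for n ≠ 0, which makes the expansion finite.
    Q-shrinks : ∀ n → ∣ Q n ∣ ℕ.≤ ∣ n ∣ ℕ.∸ 1
    Q-shrinks n = quotient-shrinks ∣ Q n ∣ ∣ n ∣ (begin
      ∣ Q n ∣ ℕ.* g              ≡⟨ ℤP.abs-* (Q n) (+ g) ⟨
      ∣ Q n ℤ.* + g ∣            ≡⟨ cong ∣_∣ (quotient-part (D n) (Q n ℤ.* + g)) ⟩
      ∣ (D n ℤ.+ Q n ℤ.* + g) ℤ.- D n ∣ ≡⟨ cong (λ x → ∣ x ℤ.- D n ∣) (D-Q-spec n) ⟨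
      ∣ n ℤ.- D n ∣              ≤⟨ ℤP.∣i-j∣≤∣i∣+∣j∣ n (D n) ⟩
      ∣ n ∣ ℕ.+ ∣ D n ∣          ≤⟨ ℕP.+-monoʳ-≤ ∣ n ∣ (D-balanced n) ⟩
      ∣ n ∣ ℕ.+ h                ∎)
      where
        open ℕP.≤-Reasoning
        quotient-part : ∀ d x → x ≡ (d ℤ.+ x) ℤ.- d
        quotient-part = solve-∀

    orbit : ℕ → ℤ → ℤ
    orbit zero n = n
    orbit (suc i) n = orbit i (Q n)

    digit : ℤ → ℕ → ℤ
    digit n i = D (orbit i n)

    orbit-suc : ∀ i n → orbit (suc i) n ≡ Q (orbit i n)
    orbit-suc zero n = refl
    orbit-suc (suc i) n = orbit-suc i (Q n)

    orbit-shrinks : ∀ i n → ∣ orbit i n ∣ ℕ.≤ ∣ n ∣ ℕ.∸ i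
    orbit-shrinks zero n = ℕP.≤-refl
    orbit-shrinks (suc i) n = ℕP.≤-trans (orbit-shrinks i (Q n))
      (ℕP.≤-trans (ℕP.∸-monoˡ-≤ i (Q-shrinks n)) (ℕP.≤-reflexive (ℕP.∸-+-assoc ∣ n ∣ 1 i)))

    orbit-vanishes : ∀ n i → ∣ n ∣ ℕ.≤ i → orbit i n ≡ + 0
    orbit-vanishes n i |n|≤i = ℤP.∣i∣≡0⇒i≡0 (ℕP.n≤0⇒n≡0
      (ℕP.≤-trans (orbit-shrinks i n) (ℕP.≤-reflexive (ℕP.m≤n⇒m∸n≡0 |n|≤i))))

    digit-vanishes : ∀ n i → ∣ n ∣ ℕ.≤ i → digit n i ≡ + 0
    digit-vanishes n i |n|≤i = trans (cong D (orbit-vanishes n i |n|≤i)) D-zero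

    digit-neg : ∀ n i → digit (- n) i ≡ - digit n i
    digit-neg n i = trans (cong D (orbit-neg i n)) (proj₁ (D-Q-neg (orbit i n)))
      where
        orbit-neg : ∀ i n → orbit i (- n) ≡ - orbit i n
        orbit-neg zero n = refl
        orbit-neg (suc i) n = trans (cong (orbit i) (proj₂ (D-Q-neg n))) (orbit-neg i (Q n))

    partial-expansion : ∀ K n →
      n ≡ digitValue g (digit n) K ℤ.+ orbit K n ℤ.* + (g ℕ.^ K)
    partial-expansion zero n = sym (trans (ℤP.+-identityˡ _) (ℤP.*-identityʳ n))
    partial-expansion (suc K) n = begin
      n                                       ≡⟨ partial-expansion K n ⟩
      S ℤ.+ x ℤ.* P                           ≡⟨ cong (λ y → S ℤ.+ y ℤ.* P) (D-Q-spec x) ⟩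
      S ℤ.+ (D x ℤ.+ Q x ℤ.* + g) ℤ.* P       ≡⟨ regroup S (D x) (Q x) P (+ g) ⟩
      (S ℤ.+ D x ℤ.* P) ℤ.+ Q x ℤ.* (+ g ℤ.* P)
        ≡⟨ cong₂ (λ y z → (S ℤ.+ D x ℤ.* P) ℤ.+ y ℤ.* z)
                 (sym (orbit-suc K n)) (sym (ℤP.pos-* g (g ℕ.^ K))) ⟩
      digitValue g (digit n) (suc K) ℤ.+ orbit (suc K) n ℤ.* + (g ℕ.^ suc K) ∎
      where
        open ≡-Reasoning
        S x P : ℤ
        S = digitValue g (digit n) K
        x = orbit K n
        P = + (g ℕ.^ K)
        regroup : ∀ S d q P G → S ℤ.+ (d ℤ.+ q ℤ.* G) ℤ.* P ≡ (S ℤ.+ d ℤ.* P) ℤ.+ q ℤ.* (G ℤ.* P)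
        regroup = solve-∀

    expansion-value : ∀ n → n ≡ digitValue g (digit n) ∣ n ∣
    expansion-value n = begin
      n                                              ≡⟨ partial-expansion ∣ n ∣ n ⟩
      S ℤ.+ orbit ∣ n ∣ n ℤ.* + (g ℕ.^ ∣ n ∣)       ≡⟨ cong (λ y → S ℤ.+ y ℤ.* + (g ℕ.^ ∣ n ∣))
                                                              (orbit-vanishes n ∣ n ∣ ℕP.≤-refl) ⟩
      S ℤ.+ + 0 ℤ.* + (g ℕ.^ ∣ n ∣)                 ≡⟨ cong (λ y → S ℤ.+ y) (ℤP.*-zeroˡ (+ (g ℕ.^ ∣ n ∣))) ⟩
      S ℤ.+ + 0                                      ≡⟨ ℤP.+-identityʳ S ⟩
      S                                              ∎
      where
        open ≡-Reasoning
        S : ℤ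
        S = digitValue g (digit n) ∣ n ∣

    expansion-isRep : ∀ n → IsRep g n (digit n) ∣ n ∣
    expansion-isRep n =
      (λ i → balanced⇒bounded (digit n i) (D-balanced (orbit i n))) ,
      digit-vanishes n ,
      expansion-value n

    -- Uniqueness, by induction on the support bound: the lowest digit and the
    -- value of the remaining digits form a balanced division of n.
    balanced-expansion-unique : ∀ M n δ → (∀ j → Balanced (δ j)) → SupportBelow δ M →
      n ≡ digitValue g δ M → ∀ i → δ i ≡ digit n i
    balanced-expansion-unique zero .(+ 0) δ _ vanish refl i =
      trans (vanish i ℕ.z≤n) (sym (digit-vanishes (+ 0) i ℕ.z≤n))
    balanced-expansion-unique (suc M) n δ bal vanish value = digitwise
      where
        split : D n ≡ δ 0 × Q n ≡ digitValue g (λ j → δ (suc j)) M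
        split = D-Q-unique {n} {δ 0} (bal 0) (trans value (digitValue-shift g δ M))
        digitwise : ∀ i → δ i ≡ digit n i
        digitwise zero = sym (proj₁ split)
        digitwise (suc i) =
          trans (balanced-expansion-unique M _ (λ j → δ (suc j)) (λ j → bal (suc j))
                   (λ j M≤j → vanish (suc j) (ℕ.s≤s M≤j)) refl i)
                (cong (λ q → digit q i) (sym (proj₂ split)))

    expansion-unique : ∀ n δ M → IsRep g n δ M → ∀ i → δ i ≡ digit n i
    expansion-unique n δ M (bounded , vanish , value) =
      balanced-expansion-unique M n δ (λ j → bounded⇒balanced (δ j) (bounded j)) vanish value

    -- The weight Σ|ε_i| of the expansion is the word length

    weight : ℤ → ℕ
    weight n = Σℕ< ∣ n ∣ (λ i → ∣ digit n i ∣)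

    weight-extend : ∀ n K → ∣ n ∣ ℕ.≤ K → Σℕ< K (λ i → ∣ digit n i ∣) ≡ weight n
    weight-extend n K =
      Σℕ<-extend ∣ n ∣ K _ (λ i |n|≤i → cong ∣_∣ (digit-vanishes n i |n|≤i))

    -- w n = |D n| + w (Q n), since the digits of Q n are those of n shifted by one.
    weight-step : ∀ n → weight n ≡ ∣ D n ∣ ℕ.+ weight (Q n)
    weight-step n = begin
      weight n                                     ≡⟨ weight-extend n (suc ∣ n ∣) (ℕP.n≤1+n _) ⟨
      Σℕ< (suc ∣ n ∣) (λ i → ∣ digit n i ∣)        ≡⟨ Σℕ<-shift ∣ n ∣ _ ⟩
      ∣ D n ∣ ℕ.+ Σℕ< ∣ n ∣ (λ i → ∣ digit (Q n) i ∣)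
        ≡⟨ cong (∣ D n ∣ ℕ.+_) (weight-extend (Q n) ∣ n ∣
                                  (ℕP.≤-trans (Q-shrinks n) (ℕP.m∸n≤m ∣ n ∣ 1))) ⟩
      ∣ D n ∣ ℕ.+ weight (Q n)                      ∎
      where open ≡-Reasoning

    weight-division : ∀ {n} d q → Balanced d → n ≡ d ℤ.+ q ℤ.* + g →
      weight n ≡ ∣ d ∣ ℕ.+ weight q
    weight-division {n} d q bal spec = trans (weight-step n)
      (cong₂ (λ d′ q′ → ∣ d′ ∣ ℕ.+ weight q′) (proj₁ split) (proj₂ split))
      where
        split : D n ≡ d × Q n ≡ q
        split = D-Q-unique {n} {d} {q} bal spec

    -- Negation flips the sign of every digit.
    weight-neg : ∀ n → weight (- n) ≡ weight n
    weight-neg n = trans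
      (Σℕ<-cong ∣ - n ∣ (λ i → trans (cong ∣_∣ (digit-neg n i)) (ℤP.∣-i∣≡∣i∣ (digit n i))))
      (cong (λ K → Σℕ< K (λ i → ∣ digit n i ∣)) (ℤP.∣-i∣≡∣i∣ n))

    weight-absorb : ∀ {m} d q → Balanced d → Balanced (+ 1 ℤ.+ d) → m ≡ d ℤ.+ q ℤ.* + g →
      weight (+ 1 ℤ.+ m) ℕ.≤ suc (weight m)
    weight-absorb {m} d q bal bal⁺ spec = begin
      weight (+ 1 ℤ.+ m)              ≡⟨ weight-division (+ 1 ℤ.+ d) q bal⁺ (trans (cong (λ y → + 1 ℤ.+ y) spec)
                                                                   (sym (ℤP.+-assoc (+ 1) d _))) ⟩
      ∣ + 1 ℤ.+ d ∣ ℕ.+ weight q      ≤⟨ ℕP.+-monoˡ-≤ (weight q) (ℤP.∣i+j∣≤∣i∣+∣j∣ (+ 1) d) ⟩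
      suc (∣ d ∣ ℕ.+ weight q)        ≡⟨ cong suc (weight-division d q bal spec) ⟨
      suc (weight m)                  ∎
      where open ℕP.≤-Reasoning

    -- Adding 1 changes the weight by at most 1.  When the last digit is h it
    -- overflows to -h with a carry into the quotient, handled by induction on |m|.
    weight-succ : ∀ F m → ∣ m ∣ ℕ.≤ F → weight (+ 1 ℤ.+ m) ℕ.≤ suc (weight m)
    weight-succ F m |m|≤F = by-digit F (D m) (Q m) (D-balanced m) (D-Q-spec m) |m|≤F
      where
        by-digit : ∀ F d q → Balanced d → m ≡ d ℤ.+ q ℤ.* + g → ∣ m ∣ ℕ.≤ F →
          weight (+ 1 ℤ.+ m) ℕ.≤ suc (weight m)
        by-digit F -[1+ k ] q bal spec _ =
          weight-absorb -[1+ k ] q bal (ℕP.≤-trans (ℤP.∣m⊝n∣≤m⊔n 1 (suc k)) bal) spec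
        by-digit F (+ k) q bal spec _ with k ℕ.≟ h
        ... | no k≢h = weight-absorb (+ k) q bal (ℕP.≤∧≢⇒< bal k≢h) spec
        by-digit zero (+ k) q bal spec |m|≤0 | yes refl = ⊥-elim (ℕP.<⇒≢ h≥1 (sym (cong ∣_∣ h≡0)))
          where
            h≡0 : + h ≡ + 0
            h≡0 = proj₁ (balancedDivision-unique {q = q} {q′ = + 0} bal ℕ.z≤n
                    (trans (sym spec) (ℤP.∣i∣≡0⇒i≡0 (ℕP.n≤0⇒n≡0 |m|≤0))))
        by-digit (suc F) (+ k) q bal spec |m|≤1+F | yes refl = begin
          weight (+ 1 ℤ.+ m)              ≡⟨ weight-division (- + h) (+ 1 ℤ.+ q) -h-balanced overflow ⟩
          ∣ - + h ∣ ℕ.+ weight (+ 1 ℤ.+ q) ≡⟨ cong (ℕ._+ weight (+ 1 ℤ.+ q)) (ℤP.∣-i∣≡∣i∣ (+ h)) ⟩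
          h ℕ.+ weight (+ 1 ℤ.+ q)        ≤⟨ ℕP.+-monoʳ-≤ h (weight-succ F q |q|≤F) ⟩
          h ℕ.+ suc (weight q)            ≡⟨ ℕP.+-suc h (weight q) ⟩
          suc (h ℕ.+ weight q)            ≡⟨ cong suc (weight-division (+ h) q bal spec) ⟨
          suc (weight m)                  ∎
          where
            open ℕP.≤-Reasoning
            carry : ∀ H q → + 1 ℤ.+ (H ℤ.+ q ℤ.* (+ 1 ℤ.+ (H ℤ.+ H)))
                          ≡ - H ℤ.+ (+ 1 ℤ.+ q) ℤ.* (+ 1 ℤ.+ (H ℤ.+ H))
            carry = solve-∀
            -h-balanced : Balanced (- + h)
            -h-balanced = ℕP.≤-reflexive (ℤP.∣-i∣≡∣i∣ (+ h))
            overflow : + 1 ℤ.+ m ≡ - + h ℤ.+ (+ 1 ℤ.+ q) ℤ.* + g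
            overflow = trans (cong (λ y → + 1 ℤ.+ y) spec) (carry (+ h) q)
            |q|≤F : ∣ q ∣ ℕ.≤ F
            |q|≤F = subst (λ x → ∣ x ∣ ℕ.≤ F) (proj₂ (D-Q-unique {m} {+ h} {q} bal spec))
                      (ℕP.≤-trans (Q-shrinks m) (ℕP.∸-monoˡ-≤ 1 |m|≤1+F))

    -- Adding gⁱ changes the weight by at most 1: the last digit is unchanged
    -- and gⁱ⁻¹ is added to the quotient.
    weight-add-power : ∀ i m → weight (+ (g ℕ.^ i) ℤ.+ m) ℕ.≤ suc (weight m)
    weight-add-power zero m = weight-succ ∣ m ∣ m ℕP.≤-refl
    weight-add-power (suc i) m = begin
      weight (+ (g ℕ.^ suc i) ℤ.+ m)       ≡⟨ weight-division (D m) (P ℤ.+ Q m) (D-balanced m) shifted ⟩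
      ∣ D m ∣ ℕ.+ weight (P ℤ.+ Q m)       ≤⟨ ℕP.+-monoʳ-≤ ∣ D m ∣ (weight-add-power i (Q m)) ⟩
      ∣ D m ∣ ℕ.+ suc (weight (Q m))       ≡⟨ ℕP.+-suc _ _ ⟩
      suc (∣ D m ∣ ℕ.+ weight (Q m))       ≡⟨ cong suc (weight-step m) ⟨
      suc (weight m)                       ∎
      where
        open ℕP.≤-Reasoning
        P : ℤ
        P = + (g ℕ.^ i)
        regroup : ∀ P G d q → G ℤ.* P ℤ.+ (d ℤ.+ q ℤ.* G) ≡ d ℤ.+ (P ℤ.+ q) ℤ.* G
        regroup = solve-∀
        shifted : + (g ℕ.^ suc i) ℤ.+ m ≡ D m ℤ.+ (P ℤ.+ Q m) ℤ.* + g
        shifted = trans (cong₂ ℤ._+_ (ℤP.pos-* g (g ℕ.^ i)) (D-Q-spec m))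
                        (regroup P (+ g) (D m) (Q m))

    weight-add-generator : ∀ a m → InA g a → weight (a ℤ.+ m) ℕ.≤ suc (weight m)
    weight-add-generator a m (inj₁ refl) =
      ℕP.≤-trans (ℕP.≤-reflexive (cong weight (ℤP.+-identityˡ m))) (ℕP.n≤1+n _)
    weight-add-generator a m (inj₂ (inj₁ (i , refl))) = weight-add-power i m
    weight-add-generator a m (inj₂ (inj₂ (i , refl))) = begin
      weight (- P ℤ.+ m)           ≡⟨ cong weight negated ⟩
      weight (- (P ℤ.+ - m))       ≡⟨ weight-neg (P ℤ.+ - m) ⟩
      weight (P ℤ.+ - m)           ≤⟨ weight-add-power i (- m) ⟩
      suc (weight (- m))           ≡⟨ cong suc (weight-neg m) ⟩
      suc (weight m)               ∎
      where
        open ℕP.≤-Reasoning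
        P : ℤ
        P = + (g ℕ.^ i)
        negated : - P ℤ.+ m ≡ - (P ℤ.+ - m)
        negated = sym (trans (ℤP.neg-distrib-+ P (- m)) (cong (λ y → - P ℤ.+ y) (ℤP.neg-involutive m)))

    weight-sum : ∀ xs → All (InA g) xs → weight (sumℤ xs) ℕ.≤ length xs
    weight-sum [] [] = ℕ.z≤n
    weight-sum (x ∷ xs) (x∈A ∷ xs∈A) =
      ℕP.≤-trans (weight-add-generator x (sumℤ xs) x∈A) (ℕ.s≤s (weight-sum xs xs∈A))

    expansion-sum : ∀ n → SumOf g (weight n) n
    expansion-sum n with digitValue-asSum g ∣ n ∣ (digit n)
    ... | xs , len , gens , sum = xs , len , gens , trans sum (sym (expansion-value n))

    weight-positive : ∀ n → n ≢ + 0 → 1 ℕ.≤ weight n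
    weight-positive n n≢0 with expansion-sum n
    ... | [] , _ , _ , sum = ⊥-elim (n≢0 (sym sum))
    ... | _ ∷ _ , len , _ , _ = ℕP.≤-trans (ℕ.s≤s ℕ.z≤n) (ℕP.≤-reflexive len)

    weight-isWordLength : ∀ n → IsWordLength g n (weight n)
    weight-isWordLength n = (λ { refl → refl }) , λ n≢0 →
      weight-positive n n≢0 , expansion-sum n ,
      λ { s _ (xs , len , gens , sum) →
            subst₂ ℕ._≤_ (cong weight sum) len (weight-sum xs gens) }

odd-decomposition : ∀ g → 3 ℕ.≤ g → g % 2 ≡ 1 → Σ ℕ λ h → g ≡ suc (h ℕ.+ h) × 1 ℕ.≤ h
odd-decomposition g g≥3 odd = h , g≡2h+1 , h≥1
  where
    h : ℕ
    h = g ℕ./ 2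
    g≡2h+1 : g ≡ suc (h ℕ.+ h)
    g≡2h+1 = trans (ℕD.m≡m%n+[m/n]*n g 2) (trans (cong (ℕ._+ h ℕ.* 2) odd)
               (cong suc (trans (ℕP.*-comm h 2) (cong (h ℕ.+_) (ℕP.+-identityʳ h)))))
    h≥1 : 1 ℕ.≤ h
    h≥1 with h | g≡2h+1
    ... | zero | g≡1 = ⊥-elim (ℕP.<⇒≱ (ℕ.s≤s (ℕ.s≤s ℕ.z≤n)) (ℕP.≤-trans g≥3 (ℕP.≤-reflexive g≡1)))
    ... | suc _ | _ = ℕ.s≤s ℕ.z≤n

mainTheorem7 : (g : ℕ) → 3 ℕ.≤ g → g % 2 ≡ 1 → (n : ℤ) → n ≢ + 0 →
    Σ (ℕ → ℤ) λ ε → Σ ℕ λ N →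
      IsRep g n ε N ×
      (∀ (δ : ℕ → ℤ) (M : ℕ) → IsRep g n δ M → ∀ i → δ i ≡ ε i) ×
      IsWordLength g n (Σℕ< N (λ i → ∣ ε i ∣))
mainTheorem7 g g≥3 odd n _ with odd-decomposition g g≥3 odd
... | h , refl , h≥1 =
  digit n , ∣ n ∣ , expansion-isRep n , expansion-unique n , weight-isWordLength n
  where
    open BalancedDivision h
    open Expansion h≥1
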